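{- Let $A(p)$ be an $\mathcal{L}'$-formula modalized in $p$ in which no free variable also occurs as a bound variable, and let $(A_n)_{n<\omega}$ be defined from $A(p)$ as below. For any $m,n\in\mathbb{N}$ with $m\geq n$, $\mathbf{QK}\vdash\Box^{n+1}\bot\to(A_m\leftrightarrow A_n)$.
   Context: Language $\mathcal{L}$: individual variables, $\top,\bot$, $\neg,\to$, $\forall$, $\Box$, predicate symbols; formulas built from $\top,\bot,P(u_1,\ldots,u_n)$ by $\neg,\to,\forall u,\Box$. $\mathcal{L}'$ is $\mathcal{L}$ plus one fixed propositional variable $p$. $A(p)$ is modalized in $p$ if every occurrence of $p$ is in the scope of a $\Box$. $\Box^k A$ is $A$ prefixed by $k$ boxes. The depth of an occurrence of a subformula $B$ in $A$ is the number of subformulas of $A$ of the form $\Box C$ containing that occurrence, other than $B$ itself. $A^{\top(n)}$ is obtained from $A$ by replacing every occurrence of a subformula $\Box B$ of depth $n$ by $\top$. $A(p)[B_0,\ldots,B_n]$ is obtained by substituting $B_i$ for all occurrences of $p$ of depth $i$, for each $i\leq n$. The sequence is defined recursively: $A_0:\equiv A^{\top(0)}(p)[\top]$ and $A_{n+1}:\equiv A^{\top(n+1)}(p)[\top,A_n,\ldots,A_0]$; each $A_n$ is an $\mathcal{L}$-formula. $\mathbf{QK}$: all instances of the axioms of classical first-order predicate logic and $\Box(A\to B)\to(\Box A\to\Box B)$, with rules modus ponens, generalization and necessitation. -}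

module Defs where

open import Data.Bool using (Bool; true; false; not; if_then_else_; _∨_)
open import Data.Nat using (ℕ; zero; suc; _≡ᵇ_)
open import Data.List using (List; []; _∷_; map)
open import Data.List.Membership.Propositional using (_∈_)
open import Data.Product using (_×_)
open import Data.Sum using (_⊎_)
open import Data.Empty using (⊥)
open import Data.Unit using (⊤)
open import Relation.Binary.PropositionalEquality using (_≡_; _≢_)
open import Relation.Nullary using (¬_)

-- Form false = L-formulas, Form true = L'-formulas
-- (L plus the single propositional variable p, written pv).  A predicate atom is a
-- predicate symbol (a natural number) applied to a list of variables.

data Form : Bool → Set where
  verum  : ∀ {b} → Form b
  falsum : ∀ {b} → Form b
  atom   : ∀ {b} → ℕ → List ℕ → Form b
  neg    : ∀ {b} → Form b → Form b
  _⇒_    : ∀ {b} → Form b → Form b → Form b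
  all    : ∀ {b} → ℕ → Form b → Form b
  box    : ∀ {b} → Form b → Form b
  pv     : Form true

infixr 5 _⇒_

Fm : Set
Fm = Form false

Fm′ : Set
Fm′ = Form true

_∧′_ : Fm → Fm → Fm
A ∧′ B = neg (A ⇒ neg B)

_⇔_ : Fm → Fm → Fm
A ⇔ B = (A ⇒ B) ∧′ (B ⇒ A)

boxes : ℕ → Fm → Fm
boxes zero    A = A
boxes (suc k) A = box (boxes k A)

FreeIn : ∀ {b} → ℕ → Form b → Set
FreeIn x verum      = ⊥
FreeIn x falsum     = ⊥
FreeIn x (atom P us) = x ∈ us
FreeIn x (neg A)    = FreeIn x A
FreeIn x (A ⇒ B)    = FreeIn x A ⊎ FreeIn x B
FreeIn x (all z A)  = z ≢ x × FreeIn x A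
FreeIn x (box A)    = FreeIn x A
FreeIn x pv         = ⊥

BoundIn : ∀ {b} → ℕ → Form b → Set
BoundIn x verum      = ⊥
BoundIn x falsum     = ⊥
BoundIn x (atom P us) = ⊥
BoundIn x (neg A)    = BoundIn x A
BoundIn x (A ⇒ B)    = BoundIn x A ⊎ BoundIn x B
BoundIn x (all z A)  = z ≡ x ⊎ BoundIn x A
BoundIn x (box A)    = BoundIn x A
BoundIn x pv         = ⊥

Modalized : Fm′ → Set
Modalized verum      = ⊤
Modalized falsum     = ⊤
Modalized (atom P us) = ⊤
Modalized (neg A)    = Modalized A
Modalized (A ⇒ B)    = Modalized A × Modalized B
Modalized (all z A)  = Modalized A
Modalized (box A)    = ⊤
Modalized pv         = ⊥

-- A^{⊤(n)}: replace every subformula □B of depth n by ⊤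
-- (depth = number of enclosing □-subformulas other than itself).

topAt : ℕ → Fm′ → Fm′
topAt n verum       = verum
topAt n falsum      = falsum
topAt n (atom P us) = atom P us
topAt n (neg A)     = neg (topAt n A)
topAt n (A ⇒ B)     = topAt n A ⇒ topAt n B
topAt n (all z A)   = all z (topAt n A)
topAt zero    (box A) = verum
topAt (suc n) (box A) = box (topAt n A)
topAt n pv          = pv

-- A(p)[B_0,...,B_n]: substitute B_i for the occurrences of p of depth i.
-- (Occurrences of p of depth > n never exist where this is used; they
-- are sent to ⊤ only to make the function total.)
lookupD : List Fm → Fm
lookupD []      = verum
lookupD (B ∷ _) = B

tailD : List Fm → List Fm
tailD []       = []
tailD (_ ∷ Bs) = Bs

substP : List Fm → Fm′ → Fm
substP Bs verum       = verum
substP Bs falsum      = falsum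
substP Bs (atom P us) = atom P us
substP Bs (neg A)     = neg (substP Bs A)
substP Bs (A ⇒ B)     = substP Bs A ⇒ substP Bs B
substP Bs (all z A)   = all z (substP Bs A)
substP Bs (box A)     = box (substP (tailD Bs) A)
substP Bs pv          = lookupD Bs

-- The sequence (A_n):  A_0 = A^{⊤(0)}(p)[⊤],
-- A_{n+1} = A^{⊤(n+1)}(p)[⊤, A_n, ..., A_0].
-- seqList A n is the list [A_n, ..., A_0].

mutual
  seqA : Fm′ → ℕ → Fm
  seqA A zero    = substP (verum ∷ []) (topAt zero A)
  seqA A (suc n) = substP (verum ∷ seqList A n) (topAt (suc n) A)

  seqList : Fm′ → ℕ → List Fm
  seqList A zero    = seqA A zero ∷ []
  seqList A (suc n) = seqA A (suc n) ∷ seqList A n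

-- Propositional tautologies: true under every Boolean valuation of the
-- prime formulas (atoms, ∀-formulas, □-formulas).
eval : (Fm → Bool) → Fm → Bool
eval v verum       = true
eval v falsum      = false
eval v (atom P us) = v (atom P us)
eval v (neg A)     = not (eval v A)
eval v (A ⇒ B)     = not (eval v A) ∨ eval v B
eval v (all z A)   = v (all z A)
eval v (box A)     = v (box A)

Tautology : Fm → Set
Tautology A = ∀ (v : Fm → Bool) → eval v A ≡ true

rn : ℕ → ℕ → ℕ → ℕ
rn y x u = if u ≡ᵇ x then y else u

substV : ℕ → ℕ → Fm → Fm
substV y x verum       = verum
substV y x falsum      = falsum
substV y x (atom P us) = atom P (map (rn y x) us)
substV y x (neg A)     = neg (substV y x A)
substV y x (A ⇒ B)     = substV y x A ⇒ substV y x B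
substV y x (all z A)   = if z ≡ᵇ x then all z A else all z (substV y x A)
substV y x (box A)     = box (substV y x A)

FreeFor : ℕ → ℕ → Fm → Set
FreeFor y x verum       = ⊤
FreeFor y x falsum      = ⊤
FreeFor y x (atom P us) = ⊤
FreeFor y x (neg A)     = FreeFor y x A
FreeFor y x (A ⇒ B)     = FreeFor y x A × FreeFor y x B
FreeFor y x (all z A)   = ¬ FreeIn x (all z A) ⊎ (z ≢ y × FreeFor y x A)
FreeFor y x (box A)     = FreeFor y x A

data QK⊢_ : Fm → Set where
  taut : ∀ {A} → Tautology A → QK⊢ A
  inst : ∀ {A x y} → FreeFor y x A → QK⊢ (all x A ⇒ substV y x A)
  dist : ∀ {A B x} → ¬ FreeIn x A → QK⊢ (all x (A ⇒ B) ⇒ (A ⇒ all x B))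
  axK  : ∀ {A B} → QK⊢ (box (A ⇒ B) ⇒ (box A ⇒ box B))
  mp   : ∀ {A B} → QK⊢ (A ⇒ B) → QK⊢ A → QK⊢ B
  gen  : ∀ {A x} → QK⊢ A → QK⊢ all x A
  nec  : ∀ {A} → QK⊢ A → QK⊢ box A

module Submission where

-- Under the hypothesis □^{k+1}⊥ every formula □C occurring at
-- depth k is provably equivalent to ⊤ (by necessitation of ⊥ → C).
-- Hence, under □^{k+1}⊥, cutting A off at depth a ≥ k (replacing the
-- boxes of depth a by ⊤) is equivalent to cutting it off at depth k,
-- and the formulas substituted for p only matter up to an equivalence
-- which gets one box weaker at each deeper level (the truncation lemma).
-- Since A_m and A_n are A truncated at depths m ≥ n with the earlier
-- approximants substituted for p, the theorem follows by a simultaneous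
-- induction on n, the inductive hypothesis supplying the agreement of
-- the substituted lists [A_{m-1},…,A_0] and [A_{n-1},…,A_0].

open import Defs
open import Data.Bool using (Bool; true; false; not; _∨_; _∧_; T)
open import Data.Bool.Properties using (∧-conicalˡ; ∧-conicalʳ)
open import Data.Nat using (ℕ; zero; suc; _≤_; z≤n; s≤s; _≡ᵇ_)
open import Data.Nat.Properties using (≡ᵇ⇒≡; _≟_)
open import Data.List using (List; []; _∷_; map)
open import Data.Product using (_×_; _,_; proj₁; proj₂)
open import Data.Sum using (inj₁; inj₂)
open import Data.Unit using (tt)
open import Relation.Nullary using (¬_; yes; no)
open import Relation.Binary.PropositionalEquality using (_≡_; refl; sym; cong; cong₂; subst)

-- Boolean counterparts of ⇒ and ⇔, unfolding exactly as `eval` does,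
-- so that `eval v (X ⇔ Y)` is definitionally `eval v X ⇔ᵇ eval v Y`.
_⇒ᵇ_ : Bool → Bool → Bool
a ⇒ᵇ b = not a ∨ b

_⇔ᵇ_ : Bool → Bool → Bool
a ⇔ᵇ b = not ((a ⇒ᵇ b) ⇒ᵇ not (b ⇒ᵇ a))

infixr 5 _⇒ᵇ_

BoolFun : ℕ → Set
BoolFun zero    = Bool
BoolFun (suc n) = Bool → BoolFun n

Valid : ∀ n → BoolFun n → Set
Valid zero    b = b ≡ true
Valid (suc n) f = ∀ a → Valid n (f a)

truthTable : ∀ n → BoolFun n → Bool
truthTable zero    b = b
truthTable (suc n) f = truthTable n (f true) ∧ truthTable n (f false)

-- A successful truth-table check proves validity; instances are then
-- QK-theorems via `taut`, applying the result to the values `eval v X`.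
truthTable-sound : ∀ n f → truthTable n f ≡ true → Valid n f
truthTable-sound zero    b ok       = ok
truthTable-sound (suc n) f ok true  =
  truthTable-sound n (f true) (∧-conicalˡ _ _ ok)
truthTable-sound (suc n) f ok false =
  truthTable-sound n (f false) (∧-conicalʳ _ _ ok)

_⊢_ : Fm → Fm → Set
H ⊢ A = QK⊢ (H ⇒ A)

infix 3 _⊢_

weaken : ∀ {H A} → QK⊢ A → H ⊢ A
weaken {H} {A} ⊢A = mp (taut λ v →
  truthTable-sound 2 (λ a h → a ⇒ᵇ h ⇒ᵇ a) refl (eval v A) (eval v H)) ⊢A

mpᴴ : ∀ {H A B} → H ⊢ (A ⇒ B) → H ⊢ A → H ⊢ B
mpᴴ {H} {A} {B} ⊢A⇒B ⊢A = mp (mp (taut λ v →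
  truthTable-sound 3 (λ h a b → (h ⇒ᵇ a ⇒ᵇ b) ⇒ᵇ (h ⇒ᵇ a) ⇒ᵇ h ⇒ᵇ b) refl
    (eval v H) (eval v A) (eval v B)) ⊢A⇒B) ⊢A

lift₁ : ∀ {H A B} → QK⊢ (A ⇒ B) → H ⊢ A → H ⊢ B
lift₁ ⊢A⇒B = mpᴴ (weaken ⊢A⇒B)

lift₂ : ∀ {H A B C} → QK⊢ (A ⇒ B ⇒ C) → H ⊢ A → H ⊢ B → H ⊢ C
lift₂ ⊢A⇒B⇒C ⊢A = mpᴴ (lift₁ ⊢A⇒B⇒C ⊢A)

⇔-refl : ∀ {H} C → H ⊢ (C ⇔ C)
⇔-refl C = weaken (taut λ v →
  truthTable-sound 1 (λ c → c ⇔ᵇ c) refl (eval v C))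

⇔-intro : ∀ {H X Y} → H ⊢ (X ⇒ Y) → H ⊢ (Y ⇒ X) → H ⊢ (X ⇔ Y)
⇔-intro {X = X} {Y} = lift₂ (taut λ v →
  truthTable-sound 2 (λ x y → (x ⇒ᵇ y) ⇒ᵇ (y ⇒ᵇ x) ⇒ᵇ (x ⇔ᵇ y)) refl
    (eval v X) (eval v Y))

⇔-elimˡ : ∀ {H X Y} → H ⊢ (X ⇔ Y) → H ⊢ (X ⇒ Y)
⇔-elimˡ {X = X} {Y} = lift₁ (taut λ v →
  truthTable-sound 2 (λ x y → (x ⇔ᵇ y) ⇒ᵇ x ⇒ᵇ y) refl (eval v X) (eval v Y))

⇔-elimʳ : ∀ {H X Y} → H ⊢ (X ⇔ Y) → H ⊢ (Y ⇒ X)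
⇔-elimʳ {X = X} {Y} = lift₁ (taut λ v →
  truthTable-sound 2 (λ x y → (x ⇔ᵇ y) ⇒ᵇ y ⇒ᵇ x) refl (eval v X) (eval v Y))

neg-cong : ∀ {H X Y} → H ⊢ (X ⇔ Y) → H ⊢ (neg X ⇔ neg Y)
neg-cong {X = X} {Y} = lift₁ (taut λ v →
  truthTable-sound 2 (λ x y → (x ⇔ᵇ y) ⇒ᵇ (not x ⇔ᵇ not y)) refl
    (eval v X) (eval v Y))

imp-cong : ∀ {H X₁ Y₁ X₂ Y₂} → H ⊢ (X₁ ⇔ Y₁) → H ⊢ (X₂ ⇔ Y₂)
         → H ⊢ ((X₁ ⇒ X₂) ⇔ (Y₁ ⇒ Y₂))
imp-cong {X₁ = X₁} {Y₁} {X₂} {Y₂} = lift₂ (taut λ v →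
  truthTable-sound 4
    (λ x₁ y₁ x₂ y₂ → (x₁ ⇔ᵇ y₁) ⇒ᵇ (x₂ ⇔ᵇ y₂) ⇒ᵇ ((x₁ ⇒ᵇ x₂) ⇔ᵇ (y₁ ⇒ᵇ y₂)))
    refl (eval v X₁) (eval v Y₁) (eval v X₂) (eval v Y₂))

⇒-trans : ∀ {H X Y Z} → H ⊢ (X ⇒ Y) → H ⊢ (Y ⇒ Z) → H ⊢ (X ⇒ Z)
⇒-trans {X = X} {Y} {Z} = lift₂ (taut λ v →
  truthTable-sound 3 (λ x y z → (x ⇒ᵇ y) ⇒ᵇ (y ⇒ᵇ z) ⇒ᵇ x ⇒ᵇ z) refl
    (eval v X) (eval v Y) (eval v Z))

-- Renaming z to itself changes nothing, so ∀z X → X is an instance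
-- of the instantiation axiom.
rn-self : ∀ z u → rn z z u ≡ u
rn-self z u with u ≡ᵇ z in eq
... | true  = sym (≡ᵇ⇒≡ u z (subst T (sym eq) tt))
... | false = refl

substV-self : ∀ z (X : Fm) → substV z z X ≡ X
substV-self z verum       = refl
substV-self z falsum      = refl
substV-self z (atom P us) = cong (atom P) (map-self us)
  where
  map-self : ∀ us → map (rn z z) us ≡ us
  map-self []       = refl
  map-self (u ∷ us) = cong₂ _∷_ (rn-self z u) (map-self us)
substV-self z (neg X)     = cong neg (substV-self z X)
substV-self z (X ⇒ Y)     = cong₂ _⇒_ (substV-self z X) (substV-self z Y)
substV-self z (all w X) with w ≡ᵇ z
... | true  = refl
... | false = cong (all w) (substV-self z X)
substV-self z (box X)     = cong box (substV-self z X)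

freeFor-self : ∀ z (X : Fm) → FreeFor z z X
freeFor-self z verum       = tt
freeFor-self z falsum      = tt
freeFor-self z (atom P us) = tt
freeFor-self z (neg X)     = freeFor-self z X
freeFor-self z (X ⇒ Y)     = freeFor-self z X , freeFor-self z Y
freeFor-self z (all w X) with w ≟ z
... | yes refl = inj₁ (λ free → proj₁ free refl)
... | no  w≢z  = inj₂ (w≢z , freeFor-self z X)
freeFor-self z (box X)     = freeFor-self z X

inst-self : ∀ z (X : Fm) → QK⊢ (all z X ⇒ X)
inst-self z X =
  subst (λ Y → QK⊢ (all z X ⇒ Y)) (substV-self z X) (inst (freeFor-self z X))

genᴴ : ∀ {H A} z → ¬ FreeIn z H → H ⊢ A → H ⊢ all z A
genᴴ z z∉H ⊢A = mp (dist z∉H) (gen ⊢A)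

bound-not-free : ∀ z (X : Fm) → ¬ FreeIn z (all z X)
bound-not-free z X free = proj₁ free refl

-- ∀z (X → Y) → (∀z X → ∀z Y).
-- ∀-distribution, from instantiation at z itself and generalization.
all-dist : ∀ z (X Y : Fm) → QK⊢ (all z (X ⇒ Y) ⇒ (all z X ⇒ all z Y))
all-dist z X Y =
  lift₁ (dist (bound-not-free z X))
        (genᴴ z (bound-not-free z (X ⇒ Y))
              (⇒-trans (weaken (inst-self z X)) (inst-self z (X ⇒ Y))))

all-mono : ∀ {H X Y} z → ¬ FreeIn z H → H ⊢ (X ⇒ Y) → H ⊢ (all z X ⇒ all z Y)
all-mono {X = X} {Y} z z∉H ⊢X⇒Y = lift₁ (all-dist z X Y) (genᴴ z z∉H ⊢X⇒Y)

all-cong : ∀ {H X Y} z → ¬ FreeIn z H → H ⊢ (X ⇔ Y) → H ⊢ (all z X ⇔ all z Y)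
all-cong z z∉H ⊢X⇔Y =
  ⇔-intro (all-mono z z∉H (⇔-elimˡ ⊢X⇔Y)) (all-mono z z∉H (⇔-elimʳ ⊢X⇔Y))

-- The hypotheses □^k ⊥ are closed, so ∀-congruence applies under them.
boxes-closed : ∀ k x → ¬ FreeIn x (boxes k falsum)
boxes-closed zero    x ()
boxes-closed (suc k) x free = boxes-closed k x free

necᴴ : ∀ {H A} → H ⊢ A → box H ⊢ box A
necᴴ ⊢A = mp axK (nec ⊢A)

box-mono : ∀ {H X Y} → H ⊢ (X ⇒ Y) → box H ⊢ (box X ⇒ box Y)
box-mono ⊢X⇒Y = lift₁ axK (necᴴ ⊢X⇒Y)

box-cong : ∀ {H X Y} → H ⊢ (X ⇔ Y) → box H ⊢ (box X ⇔ box Y)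
box-cong ⊢X⇔Y = ⇔-intro (box-mono (⇔-elimˡ ⊢X⇔Y)) (box-mono (⇔-elimʳ ⊢X⇔Y))

-- Under □⊥ every □C is equivalent to ⊤: necessitate ⊥ → C.
box-trivial : ∀ (C : Fm) → box falsum ⊢ (box C ⇔ verum)
box-trivial C =
  lift₁ (taut λ v → truthTable-sound 1 (λ c → c ⇒ᵇ (c ⇔ᵇ true)) refl (eval v (box C)))
        (necᴴ (taut λ v → refl))

-- Agreement of the lists substituted for p at level k: the entries at
-- depth i = 0,…,k are equivalent under □^{k+1-i}⊥.
HeadAgree : ℕ → List Fm → List Fm → Set
HeadAgree k Xs Ys = boxes (suc k) falsum ⊢ (lookupD Xs ⇔ lookupD Ys)

Agree : ℕ → List Fm → List Fm → Set
Agree zero    Xs Ys = HeadAgree zero Xs Ys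
Agree (suc k) Xs Ys = HeadAgree (suc k) Xs Ys × Agree k (tailD Xs) (tailD Ys)

Agree-head : ∀ k {Xs Ys} → Agree k Xs Ys → HeadAgree k Xs Ys
Agree-head zero    agree = agree
Agree-head (suc k) agree = proj₁ agree

truncation : ∀ (B : Fm′) {a k} → k ≤ a → ∀ {Xs Ys} → Agree k Xs Ys
           → boxes (suc k) falsum ⊢ (substP Xs (topAt a B) ⇔ substP Ys (topAt k B))
truncation verum       k≤a agree = ⇔-refl verum
truncation falsum      k≤a agree = ⇔-refl falsum
truncation (atom P us) k≤a agree = ⇔-refl (atom P us)
truncation (neg B)     k≤a agree = neg-cong (truncation B k≤a agree)
truncation (B ⇒ C)     k≤a agree =
  imp-cong (truncation B k≤a agree) (truncation C k≤a agree)
truncation (all z B) {k = k} k≤a agree =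
  all-cong z (boxes-closed (suc k) z) (truncation B k≤a agree)
truncation (box B) {zero}  {zero}  k≤a         agree = ⇔-refl verum
truncation (box B) {suc a} {zero}  k≤a         agree = box-trivial _
truncation (box B) {suc a} {suc k} (s≤s k≤a) agree =
  box-cong (truncation B k≤a (proj₂ agree))
truncation pv {k = k} k≤a agree = Agree-head k agree

-- A_m ↔ A_n under □^{n+1}⊥, together with the agreement at level n of
-- the lists [A_m,…,A_0] and [A_n,…,A_0]; each A_m is its truncation at
-- depth m with ⊤ ∷ [A_{m-1},…,A_0] substituted for p.
mutual
  approximants-stable : ∀ A m n → n ≤ m
                      → QK⊢ (boxes (suc n) falsum ⇒ (seqA A m ⇔ seqA A n))
  approximants-stable A zero    zero    z≤n = truncation A z≤n (⇔-refl verum)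
  approximants-stable A (suc m) zero    z≤n = truncation A z≤n (⇔-refl verum)
  approximants-stable A (suc m) (suc n) (s≤s n≤m) =
    truncation A (s≤s n≤m) (⇔-refl verum , approximants-agree A m n n≤m)

  approximants-agree : ∀ A m n → n ≤ m → Agree n (seqList A m) (seqList A n)
  approximants-agree A zero    zero    z≤n = approximants-stable A zero zero z≤n
  approximants-agree A (suc m) zero    z≤n = approximants-stable A (suc m) zero z≤n
  approximants-agree A (suc m) (suc n) (s≤s n≤m) =
    approximants-stable A (suc m) (suc n) (s≤s n≤m) , approximants-agree A m n n≤m

lemma4p6 : (A : Fm′) → Modalized A
         → (∀ x → FreeIn x A → ¬ BoundIn x A)
         → (m n : ℕ) → n ≤ m
         → QK⊢ (boxes (suc n) falsum ⇒ (seqA A m ⇔ seqA A n))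
lemma4p6 A _ _ m n n≤m = approximants-stable A m n n≤m
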